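{- If $G$ is a $(k,q)$-graph, then there exist (a) a connected $(k+1,2q)$-graph and (b) a connected $(k,-q)$-graph.
   Context: All graphs are finite and simple. The independence polynomial of $G$ is $I(G;x)=\sum_{j\ge 0} s_j x^j$, where $s_j$ is the number of independent sets of size $j$ in $G$ (with $s_0=1$). The decycling number $\phi(G)$ is the minimum size of a set $S\subseteq V(G)$ with $G-S$ acyclic. A $(k,q)$-graph is a graph $G$ with $\phi(G)=k$ and $I(G;-1)=q$, where $|q|\le 2^k$. -}

module Defs where

open import Data.Bool using (Bool; true; false; T)
open import Data.Nat as ℕ using (ℕ; zero; suc; _≤_)
open import Data.Integer as ℤ using (ℤ; +_; -_)
open import Data.Fin using (Fin)
open import Data.Fin.Properties using (all?)
open import Data.Fin.Subset using (Subset; _∈_; _∉_; ∣_∣; inside; outside)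
open import Data.Fin.Subset.Properties using (_∈?_)
open import Data.List using (List; []; _∷_; _∷ʳ_; length; filter; map; upTo; sum)
open import Data.List.Relation.Unary.All using (All)
open import Data.List.Relation.Unary.Linked using (Linked)
open import Data.List.Relation.Unary.Unique.Propositional using (Unique)
open import Data.Vec using (Vec; []; _∷_)
open import Data.Product using (Σ; ∃; _×_; _,_)
open import Relation.Nullary using (¬_; Dec; yes; no)
open import Relation.Nullary.Decidable using (_×-dec_; _→-dec_; ¬?)
open import Relation.Binary.Construct.Closure.ReflexiveTransitive using (Star)
open import Relation.Binary.PropositionalEquality using (_≡_)

record Graph : Set where
  field
    n       : ℕ
    adj     : Fin n → Fin n → Bool
    symm    : ∀ u v → adj u v ≡ adj v u
    irrefl  : ∀ v → adj v v ≡ false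

module _ (G : Graph) where
  open Graph G

  E : Fin n → Fin n → Set
  E u v = T (adj u v)

  E? : ∀ u v → Dec (E u v)
  E? u v with adj u v
  ... | true  = yes _
  ... | false = no λ ()

  Connected : Set
  Connected = ∀ u v → Star E u v

  record Cycle : Set where
    field
      start    : Fin n
      rest     : List (Fin n)
      long     : 2 ≤ length rest
      distinct : Unique (start ∷ rest)
      closed   : Linked E (start ∷ rest ∷ʳ start)

  -- G - S is acyclic: no cycle of G avoids S entirely
  -- (the cycles of the induced subgraph G - S are exactly these).
  AcyclicAfterRemoving : Subset n → Set
  AcyclicAfterRemoving S =
    ¬ (Σ Cycle λ C → All (_∉ S) (Cycle.start C ∷ Cycle.rest C))

  DecyclingNumber : ℕ → Set
  DecyclingNumber k =
    (∃ λ (S : Subset n) → ∣ S ∣ ≡ k × AcyclicAfterRemoving S)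
    × (∀ (S : Subset n) → AcyclicAfterRemoving S → k ≤ ∣ S ∣)

  Independent : Subset n → Set
  Independent S = ∀ u v → u ∈ S → v ∈ S → ¬ E u v

  Independent? : ∀ S → Dec (Independent S)
  Independent? S =
    all? λ u → all? λ v → (u ∈? S) →-dec ((v ∈? S) →-dec ¬? (E? u v))

allSubsets : ∀ m → List (Subset m)
allSubsets zero    = [] ∷ []
allSubsets (suc m) =
  map (inside ∷_) (allSubsets m) Data.List.++ map (outside ∷_) (allSubsets m)

module _ (G : Graph) where
  open Graph G

  indepCount : ℕ → ℕ
  indepCount j =
    length (filter (λ S → Independent? G S ×-dec (∣ S ∣ ℕ.≟ j)) (allSubsets n))

  signPow : ℕ → ℤ
  signPow zero    = + 1
  signPow (suc j) = - signPow j

  -- I(G; -1) = Σ_{j=0}^{n} s_j (-1)^j   (s_j = 0 for j > n)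
  indepPolyAtMinusOne : ℤ
  indepPolyAtMinusOne =
    Data.List.foldr ℤ._+_ (+ 0)
      (map (λ j → signPow j ℤ.* + indepCount j) (upTo (suc n)))

KQGraph : Graph → ℕ → ℤ → Set
KQGraph G k q = DecyclingNumber G k × indepPolyAtMinusOne G ≡ q

-- I(G;-1) = Σ_S [S independent] (-1)^|S| is multiplicative under disjoint union, and φ is additive because every
-- cycle lies in one part; as φ(K₃) = 1 and I(K₃;-1) = -2, the graph K₃ ⊎ G is a (k+1,-2q)-graph.
-- To connect a graph B, add a hub w carrying a pendant vertex ℓ, and a path w – a – r to the root r of each
-- component. No cycle passes through the new vertices, so φ is unchanged; and toggling ℓ cancels the independent
-- sets avoiding w, while those containing w are {w} ∪ S with S independent in B, so I(-1) changes sign.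
-- Connecting G gives (b), connecting K₃ ⊎ G gives (a).
module Submission where

open import Defs
open import Data.Bool using (Bool; true; false; T; not; _∧_; if_then_else_)
open import Data.Empty using (⊥; ⊥-elim)
open import Data.Fin using (Fin; zero; suc; _↑ˡ_; _↑ʳ_; splitAt)
open import Data.Fin.Properties using (_≟_; any?; splitAt-↑ˡ; splitAt-↑ʳ; splitAt⁻¹-↑ˡ; splitAt⁻¹-↑ʳ; ↑ˡ-injective; ↑ʳ-injective)
open import Data.Fin.Subset using (Subset; _∈_; _∉_; _⊆_; ∣_∣; inside; outside; ⁅_⁆; Nonempty) renaming (⊥ to ∅)
open import Data.Integer as ℤ using (ℤ; +_; -_; _+_; _*_; 0ℤ; 1ℤ; -1ℤ)
import Data.Integer.Properties as ℤP
open import Data.Integer.Tactic.RingSolver using (solve-∀)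
open import Data.List as List using (List; []; _∷_; _++_; _∷ʳ_; [_]; map; foldr; filter; length; applyUpTo; upTo)
import Data.List.Properties as ListP
open import Data.List.Relation.Unary.All as All using (All; []; _∷_)
import Data.List.Relation.Unary.All.Properties as AllP
open import Data.List.Relation.Unary.Any using (here; there)
open import Data.List.Relation.Unary.Linked as Linked using (Linked; []; [-]; _∷_)
import Data.List.Relation.Unary.Linked.Properties as LinkedP
open import Data.List.Relation.Unary.Unique.Propositional using (Unique)
import Data.List.Relation.Unary.Unique.Propositional.Properties as UniqueP
import Data.List.Relation.Unary.AllPairs as AllPairs
open import Data.List.Membership.Propositional using () renaming (_∈_ to _∈ₗ_)
open import Data.List.Membership.Propositional.Properties using (∈-∃++)
open import Data.Nat as ℕ using (ℕ; zero; suc; _≤_; _<_; z≤n; s≤s)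
import Data.Nat.Properties as ℕP
import Data.Vec.Properties as VecP
open import Data.Fin.Subset.Properties using (∣p∣≤n; ∣⊥∣≡0; ∉⊥; _∈?_; x∈⁅x⁆; x∈⁅y⁆⇒x≡y; ∣⁅x⁆∣≡1; ⊆-antisym; p⊂q⇒∣p∣<∣q∣)
open import Data.Product using (Σ; ∃; _×_; _,_; proj₁; proj₂)
open import Data.Sum using (_⊎_; inj₁; inj₂; [_,_]′)
open import Data.Maybe using (Maybe; just; nothing)
open import Data.Vec as Vec using ([]; _∷_)
open import Function using (_∘_; _⇔_; mk⇔; Equivalence)
open import Relation.Nullary using (¬_; Dec; yes; no; does)
open import Relation.Nullary.Decidable using (_×-dec_; _⊎-dec_; ¬?; dec-true)
open import Relation.Binary.Construct.Closure.ReflexiveTransitive as Star using (Star; ε; _◅_; _◅◅_)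
open import Relation.Binary.PropositionalEquality hiding (J; [_])

open ≡-Reasoning

sumℤ : List ℤ → ℤ
sumℤ = foldr _+_ 0ℤ

sumℤ-++ : ∀ (xs ys : List ℤ) → sumℤ (xs ++ ys) ≡ sumℤ xs + sumℤ ys
sumℤ-++ []       ys = sym (ℤP.+-identityˡ _)
sumℤ-++ (x ∷ xs) ys = trans (cong (_+_ x) (sumℤ-++ xs ys)) (sym (ℤP.+-assoc x _ _))

module _ {A : Set} where

  sumℤ-map-cong : ∀ {f g : A → ℤ} → (∀ x → f x ≡ g x) → ∀ xs → sumℤ (map f xs) ≡ sumℤ (map g xs)
  sumℤ-map-cong f≗g xs = cong sumℤ (ListP.map-cong f≗g xs)

  sumℤ-map-zero : ∀ {f : A → ℤ} → (∀ x → f x ≡ 0ℤ) → ∀ xs → sumℤ (map f xs) ≡ 0ℤ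
  sumℤ-map-zero f≗0 []       = refl
  sumℤ-map-zero f≗0 (x ∷ xs) = cong₂ _+_ (f≗0 x) (sumℤ-map-zero f≗0 xs)

  sumℤ-map-+ : ∀ (f g : A → ℤ) xs →
    sumℤ (map (λ x → f x + g x) xs) ≡ sumℤ (map f xs) + sumℤ (map g xs)
  sumℤ-map-+ f g []       = refl
  sumℤ-map-+ f g (x ∷ xs) = trans (cong (_+_ (f x + g x)) (sumℤ-map-+ f g xs)) (interchange (f x) (g x) _ _)
    where
    interchange : ∀ a b c d → a + b + (c + d) ≡ a + c + (b + d)
    interchange = solve-∀

  sumℤ-map-*ˡ : ∀ c (f : A → ℤ) xs → sumℤ (map (λ x → c * f x) xs) ≡ c * sumℤ (map f xs)
  sumℤ-map-*ˡ c f []       = sym (ℤP.*-zeroʳ c)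
  sumℤ-map-*ˡ c f (x ∷ xs) =
    trans (cong (_+_ (c * f x)) (sumℤ-map-*ˡ c f xs)) (sym (ℤP.*-distribˡ-+ c (f x) _))

sumℤ-map-swap : ∀ {A B : Set} (f : A → B → ℤ) xs ys →
  sumℤ (map (λ x → sumℤ (map (f x) ys)) xs) ≡ sumℤ (map (λ y → sumℤ (map (λ x → f x y) xs)) ys)
sumℤ-map-swap f []       ys = sym (sumℤ-map-zero (λ _ → refl) ys)
sumℤ-map-swap f (x ∷ xs) ys = begin
  sumℤ (map (f x) ys) + sumℤ (map (λ x → sumℤ (map (f x) ys)) xs)
    ≡⟨ cong (_+_ (sumℤ (map (f x) ys))) (sumℤ-map-swap f xs ys) ⟩
  sumℤ (map (f x) ys) + sumℤ (map (λ y → sumℤ (map (λ x → f x y) xs)) ys)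
    ≡⟨ sumℤ-map-+ (f x) (λ y → sumℤ (map (λ x → f x y) xs)) ys ⟨
  sumℤ (map (λ y → sumℤ (map (λ x → f x y) (x ∷ xs))) ys) ∎

sumℤ-applyUpTo-δ : ∀ {m N} (h : ℕ → ℤ) → m < N → (∀ j → j ≢ m → h j ≡ 0ℤ) →
  sumℤ (applyUpTo h N) ≡ h m
sumℤ-applyUpTo-δ {zero} {suc N} h _ off = begin
  h 0 + sumℤ (applyUpTo (h ∘ suc) N)  ≡⟨ cong (λ xs → h 0 + sumℤ xs) (ListP.map-upTo (h ∘ suc) N) ⟨
  h 0 + sumℤ (map (h ∘ suc) (upTo N)) ≡⟨ cong (_+_ (h 0)) (sumℤ-map-zero (λ j → off (suc j) λ ()) (upTo N)) ⟩
  h 0 + 0ℤ                            ≡⟨ ℤP.+-identityʳ (h 0) ⟩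
  h 0                                 ∎
sumℤ-applyUpTo-δ {suc m} {suc N} h (s≤s m<N) off = begin
  h 0 + sumℤ (applyUpTo (h ∘ suc) N) ≡⟨ cong (_+ sumℤ (applyUpTo (h ∘ suc) N)) (off 0 λ ()) ⟩
  0ℤ + sumℤ (applyUpTo (h ∘ suc) N)  ≡⟨ ℤP.+-identityˡ _ ⟩
  sumℤ (applyUpTo (h ∘ suc) N)       ≡⟨ sumℤ-applyUpTo-δ (h ∘ suc) m<N (λ j j≢m → off (suc j) (j≢m ∘ ℕP.suc-injective)) ⟩
  h (suc m)                          ∎

sumSubsets : ∀ n → (Subset n → ℤ) → ℤ
sumSubsets n f = sumℤ (map f (allSubsets n))

module _ {n : ℕ} where

  sumSubsets-∷ : ∀ (f : Subset (suc n) → ℤ) →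
    sumSubsets (suc n) f ≡ sumSubsets n (f ∘ (inside ∷_)) + sumSubsets n (f ∘ (outside ∷_))
  sumSubsets-∷ f = begin
    sumℤ (map f (map (inside ∷_) (allSubsets n) ++ map (outside ∷_) (allSubsets n)))
      ≡⟨ cong sumℤ (ListP.map-++ f (map (inside ∷_) (allSubsets n)) _) ⟩
    sumℤ (map f (map (inside ∷_) (allSubsets n)) ++ map f (map (outside ∷_) (allSubsets n)))
      ≡⟨ sumℤ-++ (map f (map (inside ∷_) (allSubsets n))) _ ⟩
    sumℤ (map f (map (inside ∷_) (allSubsets n))) + sumℤ (map f (map (outside ∷_) (allSubsets n)))
      ≡⟨ cong₂ (λ xs ys → sumℤ xs + sumℤ ys) (ListP.map-∘ {g = f} {f = inside ∷_} (allSubsets n))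
                                            (ListP.map-∘ {g = f} {f = outside ∷_} (allSubsets n)) ⟨
    sumSubsets n (f ∘ (inside ∷_)) + sumSubsets n (f ∘ (outside ∷_)) ∎

  sumSubsets-cong : ∀ {f g : Subset n → ℤ} → (∀ S → f S ≡ g S) → sumSubsets n f ≡ sumSubsets n g
  sumSubsets-cong f≗g = sumℤ-map-cong f≗g (allSubsets n)

  sumSubsets-zero : ∀ {f : Subset n → ℤ} → (∀ S → f S ≡ 0ℤ) → sumSubsets n f ≡ 0ℤ
  sumSubsets-zero f≗0 = sumℤ-map-zero f≗0 (allSubsets n)

  sumSubsets-*ˡ : ∀ c (f : Subset n → ℤ) → sumSubsets n (λ S → c * f S) ≡ c * sumSubsets n f
  sumSubsets-*ˡ c f = sumℤ-map-*ˡ c f (allSubsets n)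

  sumSubsets-neg : ∀ (f : Subset n → ℤ) → sumSubsets n (λ S → - f S) ≡ - sumSubsets n f
  sumSubsets-neg f = begin
    sumSubsets n (λ S → - f S)      ≡⟨ sumSubsets-cong (λ S → ℤP.-1*i≡-i (f S)) ⟨
    sumSubsets n (λ S → -1ℤ * f S)  ≡⟨ sumSubsets-*ˡ -1ℤ f ⟩
    -1ℤ * sumSubsets n f            ≡⟨ ℤP.-1*i≡-i _ ⟩
    - sumSubsets n f                ∎

  sumSubsets-*ʳ : ∀ c (f : Subset n → ℤ) → sumSubsets n (λ S → f S * c) ≡ sumSubsets n f * c
  sumSubsets-*ʳ c f = begin
    sumSubsets n (λ S → f S * c) ≡⟨ sumSubsets-cong (λ S → ℤP.*-comm (f S) c) ⟩
    sumSubsets n (λ S → c * f S) ≡⟨ sumSubsets-*ˡ c f ⟩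
    c * sumSubsets n f           ≡⟨ ℤP.*-comm c _ ⟩
    sumSubsets n f * c           ∎

sumSubsets-++ : ∀ m {n} (f : Subset (m ℕ.+ n) → ℤ) →
  sumSubsets (m ℕ.+ n) f ≡ sumSubsets m (λ P → sumSubsets n (λ R → f (P Vec.++ R)))
sumSubsets-++ zero    f = sym (ℤP.+-identityʳ _)
sumSubsets-++ (suc m) {n} f = begin
  sumSubsets (suc m ℕ.+ _) f
    ≡⟨ sumSubsets-∷ f ⟩
  sumSubsets (m ℕ.+ _) (f ∘ (inside ∷_)) + sumSubsets (m ℕ.+ _) (f ∘ (outside ∷_))
    ≡⟨ cong₂ _+_ (sumSubsets-++ m (f ∘ (inside ∷_))) (sumSubsets-++ m (f ∘ (outside ∷_))) ⟩
  sumSubsets m (λ P → sumSubsets _ (λ R → f (inside ∷ P Vec.++ R)))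
    + sumSubsets m (λ P → sumSubsets _ (λ R → f (outside ∷ P Vec.++ R)))
    ≡⟨ sumSubsets-∷ (λ P → sumSubsets n (λ R → f (P Vec.++ R))) ⟨
  sumSubsets (suc m) (λ P → sumSubsets n (λ R → f (P Vec.++ R))) ∎

-- The terms with first coordinate outside cancel in pairs differing only at the second coordinate.
sumSubsets-pendant : ∀ {m} (f : Subset (suc (suc m)) → ℤ) →
  (∀ R → f (inside ∷ inside ∷ R) ≡ 0ℤ) → (∀ R → f (outside ∷ inside ∷ R) ≡ - f (outside ∷ outside ∷ R)) →
  sumSubsets (suc (suc m)) f ≡ sumSubsets m (λ R → f (inside ∷ outside ∷ R))
sumSubsets-pendant {m} f both toggle = begin
  sumSubsets (suc (suc m)) f
    ≡⟨ sumSubsets-∷ f ⟩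
  sumSubsets (suc m) (f ∘ (inside ∷_)) + sumSubsets (suc m) (f ∘ (outside ∷_))
    ≡⟨ cong₂ _+_ (sumSubsets-∷ (f ∘ (inside ∷_))) (sumSubsets-∷ (f ∘ (outside ∷_))) ⟩
  (Σ[ inside , inside ] + Σ[ inside , outside ]) + (Σ[ outside , inside ] + Σ[ outside , outside ])
    ≡⟨ cong₂ _+_ (cong (_+ Σ[ inside , outside ]) (sumSubsets-zero both))
                 (cong (_+ Σ[ outside , outside ]) (trans (sumSubsets-cong toggle) (sumSubsets-neg (λ R → f (outside ∷ outside ∷ R))))) ⟩
  (0ℤ + Σ[ inside , outside ]) + (- Σ[ outside , outside ] + Σ[ outside , outside ])
    ≡⟨ cancel Σ[ inside , outside ] Σ[ outside , outside ] ⟩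
  Σ[ inside , outside ] ∎
  where
  Σ[_,_] : Bool → Bool → ℤ
  Σ[ a , b ] = sumSubsets m (λ R → f (a ∷ b ∷ R))
  cancel : ∀ x y → (0ℤ + x) + (- y + y) ≡ x
  cancel = solve-∀

sumSubsets-outsidePrefix : ∀ e {m} (f : Subset (e ℕ.+ m) → ℤ) →
  (∀ S i → i ↑ˡ m ∈ S → f S ≡ 0ℤ) →
  sumSubsets (e ℕ.+ m) f ≡ sumSubsets m (λ R → f (∅ {e} Vec.++ R))
sumSubsets-outsidePrefix zero    f vanish = refl
sumSubsets-outsidePrefix (suc e) f vanish = begin
  sumSubsets (suc e ℕ.+ _) f
    ≡⟨ sumSubsets-∷ f ⟩
  sumSubsets (e ℕ.+ _) (f ∘ (inside ∷_)) + sumSubsets (e ℕ.+ _) (f ∘ (outside ∷_))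
    ≡⟨ cong₂ _+_ (sumSubsets-zero (λ S → vanish (inside ∷ S) zero Vec.here))
                 (sumSubsets-outsidePrefix e (f ∘ (outside ∷_)) (λ S i i∈S → vanish (outside ∷ S) (suc i) (Vec.there i∈S))) ⟩
  0ℤ + sumSubsets _ (λ R → f (∅ {suc e} Vec.++ R))
    ≡⟨ ℤP.+-identityˡ _ ⟩
  sumSubsets _ (λ R → f (∅ {suc e} Vec.++ R)) ∎

↑ˡ-or-↑ʳ : ∀ m {n} (u : Fin (m ℕ.+ n)) → (∃ λ x → x ↑ˡ n ≡ u) ⊎ (∃ λ y → m ↑ʳ y ≡ u)
↑ˡ-or-↑ʳ m u with splitAt m u in eq
... | inj₁ x = inj₁ (x , splitAt⁻¹-↑ˡ eq)
... | inj₂ y = inj₂ (y , splitAt⁻¹-↑ʳ eq)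

preimage : ∀ {m n} → (Fin m → Fin n) → Subset n → Subset m
preimage f T = Vec.tabulate (λ b → Vec.lookup T (f b))

module _ {m n} {f : Fin m → Fin n} {T : Subset n} where

  ∈-preimage⁺ : ∀ {b} → f b ∈ T → b ∈ preimage f T
  ∈-preimage⁺ {b} fb∈T = VecP.lookup⇒[]= b _ (trans (VecP.lookup∘tabulate _ b) (VecP.[]=⇒lookup fb∈T))

  ∈-preimage⁻ : ∀ {b} → b ∈ preimage f T → f b ∈ T
  ∈-preimage⁻ {b} b∈ = VecP.lookup⇒[]= (f b) T (trans (sym (VecP.lookup∘tabulate _ b)) (VecP.[]=⇒lookup b∈))

∈-++⁺ˡ : ∀ {m n} {P : Subset m} {R : Subset n} {x} → x ∈ P → x ↑ˡ n ∈ P Vec.++ R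
∈-++⁺ˡ Vec.here      = Vec.here
∈-++⁺ˡ (Vec.there i) = Vec.there (∈-++⁺ˡ i)

∈-++⁻ˡ : ∀ {m n} {P : Subset m} {R : Subset n} x → x ↑ˡ n ∈ P Vec.++ R → x ∈ P
∈-++⁻ˡ {P = _ ∷ _} zero    Vec.here      = Vec.here
∈-++⁻ˡ {P = _ ∷ _} (suc x) (Vec.there i) = Vec.there (∈-++⁻ˡ x i)

∈-++⁺ʳ : ∀ {m n} {P : Subset m} {R : Subset n} {y} → y ∈ R → m ↑ʳ y ∈ P Vec.++ R
∈-++⁺ʳ {P = []}    i = i
∈-++⁺ʳ {P = _ ∷ _} i = Vec.there (∈-++⁺ʳ i)

∈-++⁻ʳ : ∀ {m n} {P : Subset m} {R : Subset n} {y} → m ↑ʳ y ∈ P Vec.++ R → y ∈ R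
∈-++⁻ʳ {P = []}    i             = i
∈-++⁻ʳ {P = _ ∷ _} (Vec.there i) = ∈-++⁻ʳ i

∣++∣ : ∀ {m n} (P : Subset m) (R : Subset n) → ∣ P Vec.++ R ∣ ≡ ∣ P ∣ ℕ.+ ∣ R ∣
∣++∣ []            R = refl
∣++∣ (inside ∷ P)  R = cong suc (∣++∣ P R)
∣++∣ (outside ∷ P) R = ∣++∣ P R

module _ {m n} (P : Subset m) (R : Subset n) where

  preimage-↑ˡ-++ : preimage (_↑ˡ n) (P Vec.++ R) ≡ P
  preimage-↑ˡ-++ = trans (VecP.tabulate-cong (VecP.lookup-++ˡ P R)) (VecP.tabulate∘lookup P)

  preimage-↑ʳ-++ : preimage (m ↑ʳ_) (P Vec.++ R) ≡ R
  preimage-↑ʳ-++ = trans (VecP.tabulate-cong (VecP.lookup-++ʳ P R)) (VecP.tabulate∘lookup R)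

∣preimage-↑ˡ∣+∣preimage-↑ʳ∣ : ∀ m {n} (T : Subset (m ℕ.+ n)) →
  ∣ preimage (_↑ˡ n) T ∣ ℕ.+ ∣ preimage (m ↑ʳ_) T ∣ ≡ ∣ T ∣
∣preimage-↑ˡ∣+∣preimage-↑ʳ∣ m T with Vec.splitAt m T
... | P , R , refl = trans (cong₂ ℕ._+_ (cong ∣_∣ (preimage-↑ˡ-++ P R)) (cong ∣_∣ (preimage-↑ʳ-++ P R))) (sym (∣++∣ P R))

-- I(G;-1) as a signed sum over subsets

sign : ℕ → ℤ
sign zero    = 1ℤ
sign (suc j) = - sign j

sign-+ : ∀ i j → sign (i ℕ.+ j) ≡ sign i * sign j
sign-+ zero    j = sym (ℤP.*-identityˡ (sign j))
sign-+ (suc i) j = trans (cong -_ (sign-+ i j)) (ℤP.neg-distribˡ-* (sign i) (sign j))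

indicator : ∀ {P : Set} → Dec P → ℤ
indicator d = if does d then 1ℤ else 0ℤ

module _ {A B : Set} where

  indicator-⇔ : A ⇔ B → (a : Dec A) (b : Dec B) → indicator a ≡ indicator b
  indicator-⇔ A⇔B (yes _) (yes _) = refl
  indicator-⇔ A⇔B (no _)  (no _)  = refl
  indicator-⇔ A⇔B (yes a) (no ¬b) = ⊥-elim (¬b (Equivalence.to A⇔B a))
  indicator-⇔ A⇔B (no ¬a) (yes b) = ⊥-elim (¬a (Equivalence.from A⇔B b))

  indicator-× : (a : Dec A) (b : Dec B) → indicator (a ×-dec b) ≡ indicator a * indicator b
  indicator-× (yes _) (yes _) = refl
  indicator-× (yes _) (no _)  = refl
  indicator-× (no _)  _       = refl

indicator-no : ∀ {A : Set} (a : Dec A) → ¬ A → indicator a ≡ 0ℤ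
indicator-no (yes a) ¬a = ⊥-elim (¬a a)
indicator-no (no _)  ¬a = refl

length-filter≡sum : ∀ {A : Set} {P : A → Set} (P? : ∀ x → Dec (P x)) xs →
  + length (filter P? xs) ≡ sumℤ (map (indicator ∘ P?) xs)
length-filter≡sum P? []       = refl
length-filter≡sum P? (x ∷ xs) with does (P? x)
... | true  = trans (ℤP.pos-+ 1 _) (cong (_+_ 1ℤ) (length-filter≡sum P? xs))
... | false = trans (length-filter≡sum P? xs) (sym (ℤP.+-identityˡ _))

weight : (G : Graph) → Subset (Graph.n G) → ℤ
weight G S = indicator (Independent? G S) * sign ∣ S ∣

weight-dependent : ∀ (G : Graph) {S} → ¬ Independent G S → weight G S ≡ 0ℤ
weight-dependent G {S} dependent =
  trans (cong (_* sign ∣ S ∣) (indicator-no (Independent? G S) dependent)) (ℤP.*-zeroˡ (sign ∣ S ∣))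

weight-suc : ∀ {G H : Graph} {S S′} → Independent G S ⇔ Independent H S′ → ∣ S ∣ ≡ suc ∣ S′ ∣ →
  weight G S ≡ - weight H S′
weight-suc {G} {H} {S} {S′} S⇔S′ ∣S∣≡ = begin
  indicator (Independent? G S) * sign ∣ S ∣      ≡⟨ cong₂ _*_ (indicator-⇔ S⇔S′ (Independent? G S) (Independent? H S′)) (cong sign ∣S∣≡) ⟩
  indicator (Independent? H S′) * - sign ∣ S′ ∣  ≡⟨ ℤP.neg-distribʳ-* (indicator (Independent? H S′)) (sign ∣ S′ ∣) ⟨
  - weight H S′                                  ∎

independent-⊆ : ∀ (G : Graph) {S S′} → S′ ⊆ S → Independent G S → Independent G S′
independent-⊆ G S′⊆S ind u v u∈ v∈ = ind u v (S′⊆S u∈) (S′⊆S v∈)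

module _ (G : Graph) where
  open Graph G

  signPow≡sign : ∀ j → signPow G j ≡ sign j
  signPow≡sign zero    = refl
  signPow≡sign (suc j) = cong -_ (signPow≡sign j)

  sumℤ-upTo-weight : ∀ {N} (S : Subset n) → ∣ S ∣ < N →
    sumℤ (map (λ j → sign j * indicator (Independent? G S ×-dec (∣ S ∣ ℕ.≟ j))) (upTo N)) ≡ weight G S
  sumℤ-upTo-weight {N} S |S|<N = begin
    sumℤ (map h (upTo N))   ≡⟨ cong sumℤ (ListP.map-upTo h N) ⟩
    sumℤ (applyUpTo h N)    ≡⟨ sumℤ-applyUpTo-δ h |S|<N off ⟩
    h ∣ S ∣                                        ≡⟨ split ∣ S ∣ ⟩
    sign ∣ S ∣ * (iS * indicator (∣ S ∣ ℕ.≟ ∣ S ∣)) ≡⟨ cong (λ b → sign ∣ S ∣ * (iS * (if b then 1ℤ else 0ℤ))) (dec-true (∣ S ∣ ℕ.≟ ∣ S ∣) refl) ⟩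
    sign ∣ S ∣ * (iS * 1ℤ)                         ≡⟨ rearrange (sign ∣ S ∣) iS ⟩
    weight G S                                     ∎
    where
    iS = indicator (Independent? G S)
    h : ℕ → ℤ
    h j = sign j * indicator (Independent? G S ×-dec (∣ S ∣ ℕ.≟ j))
    split : ∀ j → h j ≡ sign j * (iS * indicator (∣ S ∣ ℕ.≟ j))
    split j = cong (sign j *_) (indicator-× (Independent? G S) (∣ S ∣ ℕ.≟ j))
    off : ∀ j → j ≢ ∣ S ∣ → h j ≡ 0ℤ
    off j j≢|S| = begin
      h j                                     ≡⟨ split j ⟩
      sign j * (iS * indicator (∣ S ∣ ℕ.≟ j)) ≡⟨ cong (λ δ → sign j * (iS * δ)) (indicator-no (∣ S ∣ ℕ.≟ j) (j≢|S| ∘ sym)) ⟩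
      sign j * (iS * 0ℤ)                      ≡⟨ cong (sign j *_) (ℤP.*-zeroʳ iS) ⟩
      sign j * 0ℤ                             ≡⟨ ℤP.*-zeroʳ (sign j) ⟩
      0ℤ                                      ∎
    rearrange : ∀ s i → s * (i * 1ℤ) ≡ i * s
    rearrange = solve-∀

  indepPolyAtMinusOne≡sumWeights : indepPolyAtMinusOne G ≡ sumSubsets n (weight G)
  indepPolyAtMinusOne≡sumWeights = begin
    sumℤ (map (λ j → signPow G j * + indepCount G j) J)
      ≡⟨ sumℤ-map-cong (λ j → cong₂ _*_ (signPow≡sign j) (length-filter≡sum (Q? j) L)) J ⟩
    sumℤ (map (λ j → sign j * sumℤ (map (indicator ∘ Q? j) L)) J)
      ≡⟨ sumℤ-map-cong (λ j → sumℤ-map-*ˡ (sign j) (indicator ∘ Q? j) L) J ⟨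
    sumℤ (map (λ j → sumℤ (map (λ S → sign j * indicator (Q? j S)) L)) J)
      ≡⟨ sumℤ-map-swap (λ j S → sign j * indicator (Q? j S)) J L ⟩
    sumℤ (map (λ S → sumℤ (map (λ j → sign j * indicator (Q? j S)) J)) L)
      ≡⟨ sumℤ-map-cong (λ S → sumℤ-upTo-weight S (s≤s (∣p∣≤n S))) L ⟩
    sumSubsets n (weight G) ∎
    where
    J = upTo (suc n)
    L = allSubsets n
    Q? : ∀ j S → Dec (Independent G S × ∣ S ∣ ≡ j)
    Q? j S = Independent? G S ×-dec (∣ S ∣ ℕ.≟ j)

module _ {A : Set} {R : A → A → Set} where

  Linked-∷ʳ : ∀ xs {a b} → Linked R (xs ∷ʳ a) → R a b → Linked R (xs ∷ʳ a ∷ʳ b)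
  Linked-∷ʳ []           _        r = r ∷ [-]
  Linked-∷ʳ (x ∷ [])     (e ∷ _)  r = e ∷ r ∷ [-]
  Linked-∷ʳ (x ∷ y ∷ xs) (e ∷ l)  r = e ∷ Linked-∷ʳ (y ∷ xs) l r

  Linked-∷ʳ⁻ : ∀ xs {a} → Linked R (xs ∷ʳ a) → Linked R xs
  Linked-∷ʳ⁻ []           _       = []
  Linked-∷ʳ⁻ (x ∷ [])     _       = [-]
  Linked-∷ʳ⁻ (x ∷ y ∷ xs) (e ∷ l) = e ∷ Linked-∷ʳ⁻ (y ∷ xs) l

  Linked-All : ∀ {P : A → Set} → (∀ {x y} → R x y → P x → P y) → ∀ {x xs} → Linked R (x ∷ xs) → P x → All P (x ∷ xs)
  Linked-All step [-]     p = p ∷ []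
  Linked-All step (r ∷ l) p = p ∷ Linked-All step l (step r p)

  Linked-constant : ∀ {P : A → Set} {C : Set} {f : A → C} → (∀ {x y} → R x y → P x → P y → f x ≡ f y) →
    ∀ {x xs} → Linked R (x ∷ xs) → All P (x ∷ xs) → All (λ y → f y ≡ f x) (x ∷ xs)
  Linked-constant step [-]     (_ ∷ [])         = refl ∷ []
  Linked-constant step (r ∷ l) (p ∷ ps@(q ∷ _)) =
    refl ∷ All.map (λ eq → trans eq (sym (step r p q))) (Linked-constant step l ps)

  Linked-lastStep : ∀ x y ys {a} → Linked R (x ∷ y ∷ ys ∷ʳ a) → ∃ λ z → z ∈ₗ y ∷ ys × R z a
  Linked-lastStep x y []       (_ ∷ r ∷ [-]) = y , here refl , r
  Linked-lastStep x y (z ∷ zs) (_ ∷ l)       with Linked-lastStep y z zs l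
  ... | w , w∈ , r = w , there w∈ , r

Unique-rotate : ∀ {A : Set} {a : A} xs → Unique (a ∷ xs) → Unique (xs ∷ʳ a)
Unique-rotate xs (a∉xs AllPairs.∷ u) =
  UniqueP.++⁺ u (All.[] AllPairs.∷ AllPairs.[]) λ { (z∈xs , here refl) → All.lookup a∉xs z∈xs refl }

module _ (G : Graph) where
  open Graph G

  E-sym : ∀ {u v} → E G u v → E G v u
  E-sym {u} {v} = subst T (symm u v)

  vertices : Cycle G → List (Fin n)
  vertices C = Cycle.start C ∷ Cycle.rest C

  CycleAvoiding : Subset n → Set
  CycleAvoiding S = Σ (Cycle G) λ C → All (_∉ S) (vertices C)

  private
    ClosedTrail : List (Fin n) → Set
    ClosedTrail xs = Unique xs × Linked (E G) (xs ++ List.take 1 xs)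

    rotateOnce : ∀ a xs → ClosedTrail (a ∷ xs) → ClosedTrail (xs ∷ʳ a)
    rotateOnce a []       t             = t
    rotateOnce a (y ∷ ys) (u , (e ∷ l)) = Unique-rotate (y ∷ ys) u , Linked-∷ʳ (y ∷ ys) l e

    rotateTo : ∀ p x q → ClosedTrail (p ++ x ∷ q) → ClosedTrail (x ∷ q ++ p)
    rotateTo []      x q t = subst ClosedTrail (cong (x ∷_) (sym (ListP.++-identityʳ q))) t
    rotateTo (a ∷ p) x q t =
      subst ClosedTrail (cong (x ∷_) (ListP.++-assoc q [ a ] p))
        (rotateTo p x (q ∷ʳ a) (subst ClosedTrail (ListP.++-assoc p (x ∷ q) [ a ]) (rotateOnce a (p ++ x ∷ q) t)))

  rotateCycle : (C : Cycle G) {x : Fin n} → x ∈ₗ vertices C → Σ (Cycle G) λ C′ → Cycle.start C′ ≡ x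
  rotateCycle C {x} x∈C with ∈-∃++ x∈C
  ... | p , q , C≡p++x∷q with rotateTo p x q (subst ClosedTrail C≡p++x∷q (Cycle.distinct C , Cycle.closed C))
  ...   | distinct , closed = record
          { start = x ; rest = q ++ p ; distinct = distinct ; closed = closed
          ; long = subst (2 ≤_) length-rest (Cycle.long C) } , refl
    where
    length-rest : length (Cycle.rest C) ≡ length (q ++ p)
    length-rest = ℕP.suc-injective (trans (cong length C≡p++x∷q) (ListP.length-++-comm p (x ∷ q)))

  All-vertices-invariant : ∀ {P : Fin n → Set} → (∀ {u v} → E G u v → P u → P v) →
    (C : Cycle G) → P (Cycle.start C) → All P (vertices C)
  All-vertices-invariant step C p = AllP.++⁻ˡ (vertices C) (Linked-All step (Cycle.closed C) p)

  cycleNeighbours : (C : Cycle G) → ∃ λ y → ∃ λ ys → ∃ λ z →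
    Cycle.rest C ≡ y ∷ ys × z ∈ₗ ys × E G (Cycle.start C) y × E G z (Cycle.start C) × Linked (E G) (y ∷ ys)
  cycleNeighbours record { start = x ; rest = y ∷ y₂ ∷ ys ; closed = e ∷ l } with Linked-lastStep y y₂ ys l
  ... | z , z∈ , r = y , y₂ ∷ ys , z , refl , z∈ , e , r , Linked-∷ʳ⁻ (y ∷ y₂ ∷ ys) l
  cycleNeighbours record { rest = _ ∷ [] ; long = s≤s () }

  startNeighbours : (C : Cycle G) → ∃ λ y → ∃ λ z →
    y ≢ z × E G (Cycle.start C) y × E G (Cycle.start C) z × y ∈ₗ vertices C × z ∈ₗ vertices C
  startNeighbours C with cycleNeighbours C | Cycle.distinct C
  ... | y , ys , z , refl , z∈ys , e-y , e-z , _ | _ AllPairs.∷ (y∉ys AllPairs.∷ _) =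
    y , z , All.lookup y∉ys z∈ys , e-y , E-sym e-z , there (here refl) , there (there z∈ys)

module _ {B H : Graph} (f : Fin (Graph.n B) → Fin (Graph.n H)) where

  module _ (f-injective : ∀ {u v} → f u ≡ f v → u ≡ v) (f-edge : ∀ {u v} → E B u v → E H (f u) (f v)) where

    mapCycle : Cycle B → Cycle H
    mapCycle C = record
      { start    = f (Cycle.start C)
      ; rest     = map f (Cycle.rest C)
      ; long     = subst (2 ≤_) (sym (ListP.length-map f (Cycle.rest C))) (Cycle.long C)
      ; distinct = UniqueP.map⁺ f-injective (Cycle.distinct C)
      ; closed   = subst (Linked (E H)) (cong (f (Cycle.start C) ∷_) (ListP.map-++ f (Cycle.rest C) [ Cycle.start C ]))
                     (LinkedP.map⁺ (Linked.map f-edge (Cycle.closed C)))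
      }

    acyclic-preimage : ∀ {T} → AcyclicAfterRemoving H T → AcyclicAfterRemoving B (preimage f T)
    acyclic-preimage acyclic (C , avoids) =
      acyclic (mapCycle C , AllP.map⁺ (All.map (λ b∉ fb∈ → b∉ (∈-preimage⁺ fb∈)) avoids))

  module _ (f-edge⁻ : ∀ {u v} → E H (f u) (f v) → E B u v) where

    private
      preimages : ∀ xs → All (λ x → ∃ λ b → f b ≡ x) xs → ∃ λ bs → map f bs ≡ xs
      preimages []       []                  = [] , refl
      preimages (x ∷ xs) ((b , refl) ∷ bs) with preimages xs bs
      ... | bs′ , refl = b ∷ bs′ , refl

    pullCycle : (C : Cycle H) → All (λ x → ∃ λ b → f b ≡ x) (vertices H C) →
      Σ (Cycle B) λ C′ → map f (vertices B C′) ≡ vertices H C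
    pullCycle C inImage with preimages _ inImage
    ... | b ∷ bs , eq with cong List.head eq | cong List.tail eq
    ...   | refl | refl = record
            { start    = b
            ; rest     = bs
            ; long     = subst (2 ≤_) (ListP.length-map f bs) (Cycle.long C)
            ; distinct = UniqueP.map⁻ (subst Unique (sym eq) (Cycle.distinct C))
            ; closed   = Linked.map f-edge⁻ (LinkedP.map⁻
                           (subst (Linked (E H)) (cong (f b ∷_) (sym (ListP.map-++ f bs [ b ]))) (Cycle.closed C)))
            } , eq

    pullCycleAvoiding : ∀ {T} ((C , _) : CycleAvoiding H T) → All (λ x → ∃ λ b → f b ≡ x) (vertices H C) →
      CycleAvoiding B (preimage f T)
    pullCycleAvoiding (C , avoids) inImage with pullCycle C inImage
    ... | C′ , eq = C′ , All.map (λ fb∉ b∈ → fb∉ (∈-preimage⁻ b∈)) (AllP.map⁻ (subst (All _) (sym eq) avoids))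

-- Disjoint unions and the triangle

module _ (K G : Graph) where
  private
    module K = Graph K
    module G = Graph G

  unionAdj : Fin K.n ⊎ Fin G.n → Fin K.n ⊎ Fin G.n → Bool
  unionAdj (inj₁ x) (inj₁ y) = K.adj x y
  unionAdj (inj₂ x) (inj₂ y) = G.adj x y
  unionAdj _        _        = false

  private
    unionAdj-sym : ∀ u v → unionAdj u v ≡ unionAdj v u
    unionAdj-sym (inj₁ x) (inj₁ y) = K.symm x y
    unionAdj-sym (inj₁ x) (inj₂ y) = refl
    unionAdj-sym (inj₂ x) (inj₁ y) = refl
    unionAdj-sym (inj₂ x) (inj₂ y) = G.symm x y

    unionAdj-irrefl : ∀ u → unionAdj u u ≡ false
    unionAdj-irrefl (inj₁ x) = K.irrefl x
    unionAdj-irrefl (inj₂ y) = G.irrefl y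

  _⊎ᴳ_ : Graph
  _⊎ᴳ_ = record
    { n      = K.n ℕ.+ G.n
    ; adj    = λ u v → unionAdj (splitAt K.n u) (splitAt K.n v)
    ; symm   = λ u v → unionAdj-sym (splitAt K.n u) (splitAt K.n v)
    ; irrefl = λ u → unionAdj-irrefl (splitAt K.n u)
    }

  private
    U = _⊎ᴳ_
    infix 4 _↝_
    _↝_ = E U

  adj-↑ˡ : ∀ x y → Graph.adj U (x ↑ˡ G.n) (y ↑ˡ G.n) ≡ K.adj x y
  adj-↑ˡ x y rewrite splitAt-↑ˡ K.n x G.n | splitAt-↑ˡ K.n y G.n = refl

  adj-↑ʳ : ∀ x y → Graph.adj U (K.n ↑ʳ x) (K.n ↑ʳ y) ≡ G.adj x y
  adj-↑ʳ x y rewrite splitAt-↑ʳ K.n G.n x | splitAt-↑ʳ K.n G.n y = refl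

  adj-↑ˡ↑ʳ : ∀ x y → Graph.adj U (x ↑ˡ G.n) (K.n ↑ʳ y) ≡ false
  adj-↑ˡ↑ʳ x y rewrite splitAt-↑ˡ K.n x G.n | splitAt-↑ʳ K.n G.n y = refl

  adj-↑ʳ↑ˡ : ∀ x y → Graph.adj U (K.n ↑ʳ x) (y ↑ˡ G.n) ≡ false
  adj-↑ʳ↑ˡ x y rewrite splitAt-↑ʳ K.n G.n x | splitAt-↑ˡ K.n y G.n = refl

  E-↑ˡ : ∀ {x y} → E K x y ⇔ (x ↑ˡ G.n ↝ y ↑ˡ G.n)
  E-↑ˡ {x} {y} = mk⇔ (subst T (sym (adj-↑ˡ x y))) (subst T (adj-↑ˡ x y))

  E-↑ʳ : ∀ {x y} → E G x y ⇔ (K.n ↑ʳ x ↝ K.n ↑ʳ y)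
  E-↑ʳ {x} {y} = mk⇔ (subst T (sym (adj-↑ʳ x y))) (subst T (adj-↑ʳ x y))

  edge-stays-left : ∀ {u v} → u ↝ v → (∃ λ x → x ↑ˡ G.n ≡ u) → ∃ λ y → y ↑ˡ G.n ≡ v
  edge-stays-left {v = v} e (x , refl) with ↑ˡ-or-↑ʳ K.n v
  ... | inj₁ left        = left
  ... | inj₂ (y , refl)  = ⊥-elim (subst T (adj-↑ˡ↑ʳ x y) e)

  edge-stays-right : ∀ {u v} → u ↝ v → (∃ λ x → K.n ↑ʳ x ≡ u) → ∃ λ y → K.n ↑ʳ y ≡ v
  edge-stays-right {v = v} e (x , refl) with ↑ˡ-or-↑ʳ K.n v
  ... | inj₁ (y , refl) = ⊥-elim (subst T (adj-↑ʳ↑ˡ x y) e)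
  ... | inj₂ right      = right

  independent-++ : ∀ P R → Independent U (P Vec.++ R) ⇔ (Independent K P × Independent G R)
  independent-++ P R = mk⇔
    (λ ind → (λ x y x∈ y∈ e → ind _ _ (∈-++⁺ˡ x∈) (∈-++⁺ˡ y∈) (Equivalence.to E-↑ˡ e))
           , (λ x y x∈ y∈ e → ind _ _ (∈-++⁺ʳ x∈) (∈-++⁺ʳ y∈) (Equivalence.to E-↑ʳ e)))
    from
    where
    from : Independent K P × Independent G R → Independent U (P Vec.++ R)
    from (indK , indG) u v u∈ v∈ e with ↑ˡ-or-↑ʳ K.n u | ↑ˡ-or-↑ʳ K.n v
    ... | inj₁ (x , refl) | inj₁ (y , refl) = indK x y (∈-++⁻ˡ x u∈) (∈-++⁻ˡ y v∈) (Equivalence.from E-↑ˡ e)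
    ... | inj₁ (x , refl) | inj₂ (y , refl) = subst T (adj-↑ˡ↑ʳ x y) e
    ... | inj₂ (x , refl) | inj₁ (y , refl) = subst T (adj-↑ʳ↑ˡ x y) e
    ... | inj₂ (x , refl) | inj₂ (y , refl) = indG x y (∈-++⁻ʳ u∈) (∈-++⁻ʳ v∈) (Equivalence.from E-↑ʳ e)

  weight-++ : ∀ P R → weight U (P Vec.++ R) ≡ weight K P * weight G R
  weight-++ P R = begin
    indicator (Independent? U (P Vec.++ R)) * sign ∣ P Vec.++ R ∣
      ≡⟨ cong₂ _*_ (indicator-⇔ (independent-++ P R) (Independent? U (P Vec.++ R)) (Independent? K P ×-dec Independent? G R))
                   (trans (cong sign (∣++∣ P R)) (sign-+ ∣ P ∣ ∣ R ∣)) ⟩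
    indicator (Independent? K P ×-dec Independent? G R) * (sign ∣ P ∣ * sign ∣ R ∣)
      ≡⟨ cong (_* (sign ∣ P ∣ * sign ∣ R ∣)) (indicator-× (Independent? K P) (Independent? G R)) ⟩
    indicator (Independent? K P) * indicator (Independent? G R) * (sign ∣ P ∣ * sign ∣ R ∣)
      ≡⟨ interchange (indicator (Independent? K P)) (indicator (Independent? G R)) (sign ∣ P ∣) (sign ∣ R ∣) ⟩
    weight K P * weight G R ∎
    where
    interchange : ∀ a b c d → a * b * (c * d) ≡ a * c * (b * d)
    interchange = solve-∀

  sumWeights-⊎ : sumSubsets (K.n ℕ.+ G.n) (weight U) ≡ sumSubsets K.n (weight K) * sumSubsets G.n (weight G)
  sumWeights-⊎ = begin
    sumSubsets (K.n ℕ.+ G.n) (weight U)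
      ≡⟨ sumSubsets-++ K.n (weight U) ⟩
    sumSubsets K.n (λ P → sumSubsets G.n (λ R → weight U (P Vec.++ R)))
      ≡⟨ sumSubsets-cong (λ P → sumSubsets-cong (weight-++ P)) ⟩
    sumSubsets K.n (λ P → sumSubsets G.n (λ R → weight K P * weight G R))
      ≡⟨ sumSubsets-cong (λ P → sumSubsets-*ˡ (weight K P) (weight G)) ⟩
    sumSubsets K.n (λ P → weight K P * sumSubsets G.n (weight G))
      ≡⟨ sumSubsets-*ʳ (sumSubsets G.n (weight G)) (weight K) ⟩
    sumSubsets K.n (weight K) * sumSubsets G.n (weight G) ∎

  decyclingNumber-⊎ : ∀ {a b} → DecyclingNumber K a → DecyclingNumber G b → DecyclingNumber U (a ℕ.+ b)
  decyclingNumber-⊎ {a} {b} ((SK , |SK|≡a , acyclicK) , minimalK) ((SG , |SG|≡b , acyclicG) , minimalG) =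
    (SK Vec.++ SG , trans (∣++∣ SK SG) (cong₂ ℕ._+_ |SK|≡a |SG|≡b) , acyclic) , minimal
    where
    acyclic : AcyclicAfterRemoving U (SK Vec.++ SG)
    acyclic (C , avoids) with ↑ˡ-or-↑ʳ K.n (Cycle.start C)
    ... | inj₁ start-left  = acyclicK (subst (CycleAvoiding K) (preimage-↑ˡ-++ SK SG)
            (pullCycleAvoiding (_↑ˡ G.n) (Equivalence.from E-↑ˡ) (C , avoids) (All-vertices-invariant U edge-stays-left C start-left)))
    ... | inj₂ start-right = acyclicG (subst (CycleAvoiding G) (preimage-↑ʳ-++ SK SG)
            (pullCycleAvoiding (K.n ↑ʳ_) (Equivalence.from E-↑ʳ) (C , avoids) (All-vertices-invariant U edge-stays-right C start-right)))
    minimal : ∀ T → AcyclicAfterRemoving U T → a ℕ.+ b ≤ ∣ T ∣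
    minimal T acyclicT = ℕP.≤-trans
      (ℕP.+-mono-≤ (minimalK _ (acyclic-preimage (_↑ˡ G.n) (↑ˡ-injective G.n _ _) (Equivalence.to E-↑ˡ) acyclicT))
                   (minimalG _ (acyclic-preimage (K.n ↑ʳ_) (↑ʳ-injective K.n _ _) (Equivalence.to E-↑ʳ) acyclicT)))
      (ℕP.≤-reflexive (∣preimage-↑ˡ∣+∣preimage-↑ʳ∣ K.n T))

  kqGraph-⊎ : ∀ {a b p q} → KQGraph K a p → KQGraph G b q → KQGraph U (a ℕ.+ b) (p * q)
  kqGraph-⊎ (φK , IK) (φG , IG) = decyclingNumber-⊎ φK φG , (begin
    indepPolyAtMinusOne U                                   ≡⟨ indepPolyAtMinusOne≡sumWeights U ⟩
    sumSubsets (K.n ℕ.+ G.n) (weight U)                     ≡⟨ sumWeights-⊎ ⟩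
    sumSubsets K.n (weight K) * sumSubsets G.n (weight G)   ≡⟨ cong₂ _*_ (indepPolyAtMinusOne≡sumWeights K) (indepPolyAtMinusOne≡sumWeights G) ⟨
    indepPolyAtMinusOne K * indepPolyAtMinusOne G           ≡⟨ cong₂ _*_ IK IG ⟩
    _ ∎)

complete : ℕ → Graph
complete m = record { n = m ; adj = λ u v → not (does (u ≟ v)) ; symm = symm ; irrefl = λ v → cong not (dec-true (v ≟ v) refl) }
  where
  symm : ∀ (u v : Fin m) → not (does (u ≟ v)) ≡ not (does (v ≟ u))
  symm u v with u ≟ v | v ≟ u
  ... | yes _   | yes _   = refl
  ... | no  _   | no  _   = refl
  ... | yes u≡v | no  v≢u = ⊥-elim (v≢u (sym u≡v))
  ... | no  u≢v | yes v≡u = ⊥-elim (u≢v (sym v≡u))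

triangle : Graph
triangle = complete 3

triangle-cycle : Cycle triangle
triangle-cycle = record
  { start    = zero
  ; rest     = suc zero ∷ suc (suc zero) ∷ []
  ; long     = s≤s (s≤s z≤n)
  ; distinct = ((λ ()) ∷ (λ ()) ∷ []) AllPairs.∷ ((λ ()) ∷ []) AllPairs.∷ [] AllPairs.∷ AllPairs.[]
  ; closed   = _ ∷ _ ∷ _ ∷ [-]
  }

no-three-distinct-nonzero : ∀ (a b c : Fin 3) → All (_∉ ⁅ zero ⁆) (a ∷ b ∷ c ∷ []) → a ≢ b → a ≢ c → b ≢ c → ⊥
no-three-distinct-nonzero zero             _                _                (a∉ ∷ _)          _   _   _   = a∉ Vec.here
no-three-distinct-nonzero _                zero             _                (_ ∷ b∉ ∷ _)      _   _   _   = b∉ Vec.here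
no-three-distinct-nonzero _                _                zero             (_ ∷ _ ∷ c∉ ∷ _)  _   _   _   = c∉ Vec.here
no-three-distinct-nonzero (suc zero)       (suc zero)       _                _                 a≢b _   _   = a≢b refl
no-three-distinct-nonzero (suc (suc zero)) (suc (suc zero)) _                _                 a≢b _   _   = a≢b refl
no-three-distinct-nonzero (suc zero)       (suc (suc zero)) (suc zero)       _                 _   a≢c _   = a≢c refl
no-three-distinct-nonzero (suc (suc zero)) (suc zero)       (suc (suc zero)) _                 _   a≢c _   = a≢c refl
no-three-distinct-nonzero (suc zero)       (suc (suc zero)) (suc (suc zero)) _                 _   _   b≢c = b≢c refl
no-three-distinct-nonzero (suc (suc zero)) (suc zero)       (suc zero)       _                 _   _   b≢c = b≢c refl

decyclingNumber-triangle : DecyclingNumber triangle 1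
decyclingNumber-triangle = (⁅ zero ⁆ , refl , acyclic) , minimal
  where
  acyclic : AcyclicAfterRemoving triangle ⁅ zero ⁆
  acyclic (record { start = a ; rest = b ∷ c ∷ _ ; distinct = (a≢b ∷ a≢c ∷ _) AllPairs.∷ (b≢c ∷ _) AllPairs.∷ _ } , a∉ ∷ b∉ ∷ c∉ ∷ _) =
    no-three-distinct-nonzero a b c (a∉ ∷ b∉ ∷ c∉ ∷ []) a≢b a≢c b≢c
  acyclic (record { rest = _ ∷ [] ; long = s≤s () } , _)
  minimal : ∀ S → AcyclicAfterRemoving triangle S → 1 ≤ ∣ S ∣
  minimal (inside ∷ _)                            _       = s≤s z≤n
  minimal (outside ∷ inside ∷ _)                  _       = s≤s z≤n
  minimal (outside ∷ outside ∷ inside ∷ [])       _       = s≤s z≤n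
  minimal (outside ∷ outside ∷ outside ∷ []) acyclic =
    ⊥-elim (acyclic (triangle-cycle , (λ ()) ∷ (λ { (Vec.there ()) }) ∷ (λ { (Vec.there (Vec.there ())) }) ∷ []))

kqGraph-triangle : KQGraph triangle 1 (- + 2)
kqGraph-triangle = decyclingNumber-triangle , refl

-- Connected components

pick : ∀ {n} (R : Subset n) → Nonempty R → Fin n
pick R nonempty with any? (_∈? R)
... | yes (x , _) = x
... | no  ∄x      = ⊥-elim (∄x nonempty)

pick-∈ : ∀ {n} (R : Subset n) nonempty → pick R nonempty ∈ R
pick-∈ R nonempty with any? (_∈? R)
... | yes (_ , x∈R) = x∈R
... | no  ∄x        = ⊥-elim (∄x nonempty)

pick-cong : ∀ {n} {R R′ : Subset n} → R ≡ R′ → ∀ nonempty nonempty′ → pick R nonempty ≡ pick R′ nonempty′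
pick-cong {R = R} refl nonempty nonempty′ with any? (_∈? R)
... | yes _  = refl
... | no  ∄x = ⊥-elim (∄x nonempty)

module _ (G : Graph) where
  open Graph G

  private
    _⇝_ : Fin n → Fin n → Set
    _⇝_ = Star (E G)

    Step : Subset n → Fin n → Fin n → Set
    Step R x y = y ∈ R × (E G y x ⊎ y ≡ x)

    step? : ∀ R x y → Dec (Step R x y)
    step? R x y = (y ∈? R) ×-dec (E? G y x ⊎-dec (y ≟ x))

    grow : Subset n → Subset n
    grow R = Vec.tabulate λ x → does (any? (step? R x))

    grow-sound : ∀ {R x} → x ∈ grow R → ∃ (Step R x)
    grow-sound {R} {x} x∈ with any? (step? R x) | trans (sym (VecP.lookup∘tabulate _ x)) (VecP.[]=⇒lookup x∈)
    ... | yes step | _ = step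
    ... | no  _    | ()

    grow-intro : ∀ {R x y} → Step R x y → x ∈ grow R
    grow-intro {R} {x} {y} step = VecP.lookup⇒[]= x _ (trans (VecP.lookup∘tabulate _ x) found)
      where
      found : does (any? (step? R x)) ≡ true
      found = dec-true (any? (step? R x)) (y , step)

    ⊆-grow : ∀ {R} → R ⊆ grow R
    ⊆-grow x∈ = grow-intro (x∈ , inj₂ refl)

    grow-stable : ∀ {R} → grow R ⊆ R → grow (grow R) ⊆ grow R
    grow-stable {R} closed rewrite ⊆-antisym closed ⊆-grow = closed

    reachWithin : ℕ → Fin n → Subset n
    reachWithin zero    u = ⁅ u ⁆
    reachWithin (suc k) u = grow (reachWithin k u)

    reachWithin-sound : ∀ k {u x} → x ∈ reachWithin k u → u ⇝ x
    reachWithin-sound zero    {u} x∈ rewrite x∈⁅y⁆⇒x≡y u x∈ = ε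
    reachWithin-sound (suc k) x∈ with grow-sound x∈
    ... | y , y∈ , inj₁ e    = reachWithin-sound k y∈ ◅◅ (e ◅ ε)
    ... | y , y∈ , inj₂ refl = reachWithin-sound k y∈

    -- Until it stabilises, the k-step neighbourhood gains a vertex with every step, so n steps suffice.
    stable-or-growing : ∀ k u → grow (reachWithin k u) ⊆ reachWithin k u ⊎ k < ∣ reachWithin k u ∣
    stable-or-growing zero    u = inj₂ (ℕP.≤-reflexive (sym (∣⁅x⁆∣≡1 u)))
    stable-or-growing (suc k) u with stable-or-growing k u
    ... | inj₁ closed = inj₁ (grow-stable closed)
    ... | inj₂ k<∣R∣ with any? (λ x → (x ∈? reachWithin (suc k) u) ×-dec ¬? (x ∈? reachWithin k u))
    ...   | yes (x , new , old) = inj₂ (ℕP.<-≤-trans (s≤s k<∣R∣) (p⊂q⇒∣p∣<∣q∣ (⊆-grow , x , new , old)))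
    ...   | no ∄new             = inj₁ (grow-stable closed)
      where
      closed : grow (reachWithin k u) ⊆ reachWithin k u
      closed {x} x∈ with x ∈? reachWithin k u
      ... | yes old = old
      ... | no  new = ⊥-elim (∄new (x , x∈ , new))

  reachable : Fin n → Subset n
  reachable = reachWithin n

  private
    reachable-closed : ∀ {u} → grow (reachable u) ⊆ reachable u
    reachable-closed {u} with stable-or-growing n u
    ... | inj₁ closed = closed
    ... | inj₂ n<∣R∣  = ⊥-elim (ℕP.<⇒≱ n<∣R∣ (∣p∣≤n (reachable u)))

    reachWithin-self : ∀ k u → u ∈ reachWithin k u
    reachWithin-self zero    u = x∈⁅x⁆ u
    reachWithin-self (suc k) u = ⊆-grow (reachWithin-self k u)

    reachable-extend : ∀ {u x y} → y ∈ reachable u → y ⇝ x → x ∈ reachable u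
    reachable-extend y∈ ε       = y∈
    reachable-extend y∈ (e ◅ p) = reachable-extend (reachable-closed (grow-intro (y∈ , inj₁ e))) p

  ∈-reachable⇔ : ∀ {u x} → x ∈ reachable u ⇔ u ⇝ x
  ∈-reachable⇔ {u} = mk⇔ (reachWithin-sound n) (reachable-extend (reachWithin-self n u))

  ⇝-sym : ∀ {u v} → u ⇝ v → v ⇝ u
  ⇝-sym = Star.reverse (E-sym G)

  reachable-cong : ∀ {u v} → u ⇝ v → reachable u ≡ reachable v
  reachable-cong u⇝v = ⊆-antisym
    (λ x∈ → Equivalence.from ∈-reachable⇔ (⇝-sym u⇝v ◅◅ Equivalence.to ∈-reachable⇔ x∈))
    (λ x∈ → Equivalence.from ∈-reachable⇔ (u⇝v ◅◅ Equivalence.to ∈-reachable⇔ x∈))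

  root : Fin n → Fin n
  root v = pick (reachable v) (v , Equivalence.from ∈-reachable⇔ ε)

  root-reachable : ∀ v → v ⇝ root v
  root-reachable v = Equivalence.to ∈-reachable⇔ (pick-∈ (reachable v) _)

  root-cong : ∀ {u v} → u ⇝ v → root u ≡ root v
  root-cong u⇝v = pick-cong (reachable-cong u⇝v) _ _

  root-idempotent : ∀ v → root (root v) ≡ root v
  root-idempotent v = sym (root-cong (root-reachable v))

-- Joining the components of a graph

module _ (B : Graph) where
  open Graph B

  data Vertex : Set where
    hub pendant : Vertex
    link base   : Fin n → Vertex

  attached : Fin n → Fin n → Bool
  attached j b = does (j ≟ b) ∧ does (root B j ≟ j)

  adjacent : Vertex → Vertex → Bool
  adjacent hub      pendant  = true
  adjacent pendant  hub      = true
  adjacent hub      (link _) = true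
  adjacent (link _) hub      = true
  adjacent (link j) (base b) = attached j b
  adjacent (base b) (link j) = attached j b
  adjacent (base b) (base c) = adj b c
  adjacent _        _        = false

  private
    adjacent-sym : ∀ v w → adjacent v w ≡ adjacent w v
    adjacent-sym hub      hub      = refl
    adjacent-sym hub      pendant  = refl
    adjacent-sym hub      (link _) = refl
    adjacent-sym hub      (base _) = refl
    adjacent-sym pendant  hub      = refl
    adjacent-sym pendant  pendant  = refl
    adjacent-sym pendant  (link _) = refl
    adjacent-sym pendant  (base _) = refl
    adjacent-sym (link _) hub      = refl
    adjacent-sym (link _) pendant  = refl
    adjacent-sym (link _) (link _) = refl
    adjacent-sym (link _) (base _) = refl
    adjacent-sym (base _) hub      = refl
    adjacent-sym (base _) pendant  = refl
    adjacent-sym (base _) (link _) = refl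
    adjacent-sym (base b) (base c) = symm b c

    adjacent-irrefl : ∀ v → adjacent v v ≡ false
    adjacent-irrefl hub      = refl
    adjacent-irrefl pendant  = refl
    adjacent-irrefl (link _) = refl
    adjacent-irrefl (base b) = irrefl b

  decode : Fin (suc (suc (n ℕ.+ n))) → Vertex
  decode zero          = hub
  decode (suc zero)    = pendant
  decode (suc (suc x)) = [ link , base ]′ (splitAt n x)

  encode : Vertex → Fin (suc (suc (n ℕ.+ n)))
  encode hub      = zero
  encode pendant  = suc zero
  encode (link j) = suc (suc (j ↑ˡ n))
  encode (base b) = suc (suc (n ↑ʳ b))

  decode-encode : ∀ v → decode (encode v) ≡ v
  decode-encode hub      = refl
  decode-encode pendant  = refl
  decode-encode (link j) = cong [ link , base ]′ (splitAt-↑ˡ n j n)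
  decode-encode (base b) = cong [ link , base ]′ (splitAt-↑ʳ n n b)

  encode-decode : ∀ x → encode (decode x) ≡ x
  encode-decode zero          = refl
  encode-decode (suc zero)    = refl
  encode-decode (suc (suc x)) with ↑ˡ-or-↑ʳ n x
  ... | inj₁ (j , refl) = cong encode (decode-encode (link j))
  ... | inj₂ (b , refl) = cong encode (decode-encode (base b))

  decode-injective : ∀ {x y} → decode x ≡ decode y → x ≡ y
  decode-injective {x} {y} eq = trans (sym (encode-decode x)) (trans (cong encode eq) (encode-decode y))

  -- B plus a hub with a pendant vertex and a neighbour link j for each j; link j is joined to base j iff j is a root,
  -- so each component of B hangs from the hub by a single path of length two.
  joinComponents : Graph
  joinComponents = record
    { n      = suc (suc (n ℕ.+ n))
    ; adj    = λ x y → adjacent (decode x) (decode y)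
    ; symm   = λ x y → adjacent-sym (decode x) (decode y)
    ; irrefl = λ x → adjacent-irrefl (decode x)
    }

  private
    J = joinComponents
    infix 4 _~_
    _~_ : Vertex → Vertex → Set
    v ~ w = T (adjacent v w)

  E-encode : ∀ {v w} → v ~ w → E J (encode v) (encode w)
  E-encode {v} {w} = subst₂ _~_ (sym (decode-encode v)) (sym (decode-encode w))

  embed : Fin n → Fin (suc (suc (n ℕ.+ n)))
  embed b = suc (suc n) ↑ʳ b

  E-embed : ∀ {u v} → E B u v ⇔ E J (embed u) (embed v)
  E-embed {u} {v} = mk⇔ (E-encode {base u} {base v}) (subst₂ _~_ (decode-encode (base u)) (decode-encode (base v)))

  attached-root : ∀ b → T (attached (root B b) (root B b))
  attached-root b rewrite dec-true (root B b ≟ root B b) refl | dec-true (root B (root B b) ≟ root B b) (root-idempotent B b) = _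

  attached⇒ : ∀ {j b} → T (attached j b) → j ≡ b × root B j ≡ j
  attached⇒ {j} {b} t with j ≟ b | root B j ≟ j
  ... | yes j≡b | yes isRoot = j≡b , isRoot

  joinComponents-connected : Connected J
  joinComponents-connected x y = toHub x ◅◅ ⇝-sym J (toHub y)
    where
    toHub′ : ∀ v → Star (E J) (encode v) zero
    toHub′ hub      = ε
    toHub′ pendant  = E-encode {pendant} {hub} _ ◅ ε
    toHub′ (link j) = E-encode {link j} {hub} _ ◅ ε
    toHub′ (base b) = Star.gmap embed (Equivalence.to E-embed) (root-reachable B b)
                      ◅◅ (E-encode {base (root B b)} {link (root B b)} (attached-root b) ◅ toHub′ (link (root B b)))
    toHub : ∀ x → Star (E J) x zero
    toHub x = subst (λ x → Star (E J) x zero) (encode-decode x) (toHub′ (decode x))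

  label : Vertex → Maybe (Fin n)
  label (link j) = just j
  label (base b) = just (root B b)
  label _        = nothing

  label-edge : ∀ {v w} → v ~ w → v ≢ hub → w ≢ hub → label v ≡ label w
  label-edge {hub}              _ v≢hub _     = ⊥-elim (v≢hub refl)
  label-edge {w = hub}          _ _     w≢hub = ⊥-elim (w≢hub refl)
  label-edge {link j} {base b}  e _     _     with attached⇒ {j} {b} e
  ... | refl , isRoot = cong just (sym isRoot)
  label-edge {base b} {link j}  e _     _     with attached⇒ {j} {b} e
  ... | refl , isRoot = cong just isRoot
  label-edge {base b} {base c}  e _     _     = cong just (root-cong B (e ◅ ε))
  label-edge {pendant} {pendant} ()
  label-edge {pendant} {link _}  ()
  label-edge {pendant} {base _}  ()
  label-edge {link _} {pendant}  ()
  label-edge {link _} {link _}   ()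
  label-edge {base _} {pendant}  ()

  hub-neighbour-by-label : ∀ {v w} → hub ~ v → hub ~ w → label v ≡ label w → v ≡ w
  hub-neighbour-by-label {pendant} {pendant} _ _ _    = refl
  hub-neighbour-by-label {link j}  {link .j} _ _ refl = refl

  pendant-neighbour : ∀ {w} → pendant ~ w → w ≡ hub
  pendant-neighbour {hub} _ = refl

  link-neighbour : ∀ {j w} → link j ~ w → w ≢ hub → w ≡ base j
  link-neighbour {w = hub}    _ w≢hub = ⊥-elim (w≢hub refl)
  link-neighbour {j} {base b} e _     with attached⇒ {j} {b} e
  ... | refl , _ = refl

  -- Leaving the hub along a cycle, the path back never meets the hub, so it stays in one component.
  hub-not-on-cycle : (C : Cycle J) → All (λ x → decode x ≢ hub) (vertices J C)
  hub-not-on-cycle C = All.tabulate λ x∈C → hub-not-start (rotateCycle J C x∈C)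
    where
    hub-not-start : ∀ {x} → (Σ (Cycle J) λ C′ → Cycle.start C′ ≡ x) → decode x ≢ hub
    hub-not-start (C′ , refl) isHub with cycleNeighbours J C′ | Cycle.distinct C′
    ... | y , ys , z , refl , z∈ys , e-y , e-z , path | start∉ AllPairs.∷ (y∉ys AllPairs.∷ _) =
      All.lookup y∉ys z∈ys (decode-injective (hub-neighbour-by-label hub~y hub~z (sym (All.lookup labels (there z∈ys)))))
      where
      notHub : All (λ v → decode v ≢ hub) (y ∷ ys)
      notHub = All.map (λ start≢v vIsHub → start≢v (decode-injective (trans isHub (sym vIsHub)))) start∉
      labels : All (λ v → label (decode v) ≡ label (decode y)) (y ∷ ys)
      labels = Linked-constant (λ e p q → label-edge e p q) path notHub
      hub~y : hub ~ decode y
      hub~y = subst (_~ decode y) isHub e-y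
      hub~z : hub ~ decode z
      hub~z = subst (_~ decode z) isHub (E-sym J {z} {Cycle.start C′} e-z)

  -- Apart from the hub, pendant and link j have at most one neighbour, but a cycle vertex has two.
  cycle-in-base : (C : Cycle J) → All (λ x → ∃ λ b → embed b ≡ x) (vertices J C)
  cycle-in-base C = All.tabulate λ {x} x∈C → classify x (All.lookup (hub-not-on-cycle C) x∈C) (rotateCycle J C x∈C)
    where
    classify : ∀ x → decode x ≢ hub → (Σ (Cycle J) λ C′ → Cycle.start C′ ≡ x) → ∃ λ b → embed b ≡ x
    classify x notHub (C′ , refl) with decode x in eq | startNeighbours J C′
    ... | hub | _ = ⊥-elim (notHub refl)
    ... | base b | _ = b , trans (cong encode (sym eq)) (encode-decode x)
    ... | pendant | y , _ , _ , e-y , _ , y∈ , _ =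
      ⊥-elim (All.lookup (hub-not-on-cycle C′) y∈ (pendant-neighbour e-y))
    ... | link j | y , z , y≢z , e-y , e-z , y∈ , z∈ = ⊥-elim (y≢z (decode-injective (trans
      (link-neighbour e-y (All.lookup (hub-not-on-cycle C′) y∈))
      (sym (link-neighbour e-z (All.lookup (hub-not-on-cycle C′) z∈))))))

  decyclingNumber-joinComponents : ∀ {k} → DecyclingNumber B k → DecyclingNumber J k
  decyclingNumber-joinComponents {k} ((S , ∣S∣≡k , acyclic) , minimal) =
    (∅ {suc (suc n)} Vec.++ S , trans (∣++∣ (∅ {suc (suc n)}) S) (cong₂ ℕ._+_ (∣⊥∣≡0 (suc (suc n))) ∣S∣≡k) , acyclicJ) , minimalJ
    where
    acyclicJ : AcyclicAfterRemoving J (∅ {suc (suc n)} Vec.++ S)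
    acyclicJ (C , avoids) = acyclic (subst (CycleAvoiding B) (preimage-↑ʳ-++ (∅ {suc (suc n)}) S)
      (pullCycleAvoiding embed (Equivalence.from E-embed) (C , avoids) (cycle-in-base C)))
    minimalJ : ∀ T → AcyclicAfterRemoving J T → k ≤ ∣ T ∣
    minimalJ T acyclicT = ℕP.≤-trans
      (minimal _ (acyclic-preimage embed (↑ʳ-injective (suc (suc n)) _ _) (Equivalence.to E-embed) acyclicT))
      (ℕP.≤-trans (ℕP.m≤n+m _ _) (ℕP.≤-reflexive (∣preimage-↑ˡ∣+∣preimage-↑ʳ∣ (suc (suc n)) T)))

  private
    ∈-hubAndBase : ∀ {T x} → x ∈ inside ∷ outside ∷ (∅ {n} Vec.++ T) → x ≡ zero ⊎ ∃ λ b → embed b ≡ x × b ∈ T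
    ∈-hubAndBase {x = zero}        _                               = inj₁ refl
    ∈-hubAndBase {x = suc zero}    (Vec.there ())
    ∈-hubAndBase {x = suc (suc y)} (Vec.there (Vec.there y∈)) with ↑ˡ-or-↑ʳ n y
    ... | inj₁ (j , refl) = ⊥-elim (∉⊥ (∈-++⁻ˡ j y∈))
    ... | inj₂ (b , refl) = inj₂ (b , refl , ∈-++⁻ʳ y∈)

  independent-hubAndBase : ∀ T → Independent J (inside ∷ outside ∷ (∅ Vec.++ T)) ⇔ Independent B T
  independent-hubAndBase T = mk⇔
    (λ ind b c b∈ c∈ e → ind (embed b) (embed c) (Vec.there (Vec.there (∈-++⁺ʳ b∈))) (Vec.there (Vec.there (∈-++⁺ʳ c∈)))
                           (Equivalence.to E-embed e))
    from
    where
    from : Independent B T → Independent J (inside ∷ outside ∷ (∅ Vec.++ T))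
    from indB u v u∈ v∈ e with ∈-hubAndBase u∈ | ∈-hubAndBase v∈
    ... | inj₁ refl            | inj₁ refl            = e
    ... | inj₁ refl            | inj₂ (c , refl , _)  = subst (hub ~_) (decode-encode (base c)) e
    ... | inj₂ (b , refl , _)  | inj₁ refl            = subst (_~ hub) (decode-encode (base b)) e
    ... | inj₂ (b , refl , b∈) | inj₂ (c , refl , c∈) = indB b c b∈ c∈ (Equivalence.from E-embed e)

  independent-pendantToggle : ∀ R → Independent J (outside ∷ inside ∷ R) ⇔ Independent J (outside ∷ outside ∷ R)
  independent-pendantToggle R = mk⇔ (independent-⊆ J λ { (Vec.there (Vec.there x∈)) → Vec.there (Vec.there x∈) }) from
    where
    from : Independent J (outside ∷ outside ∷ R) → Independent J (outside ∷ inside ∷ R)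
    from ind (suc (suc x)) (suc (suc y)) (Vec.there (Vec.there x∈)) (Vec.there (Vec.there y∈)) e =
      ind _ _ (Vec.there (Vec.there x∈)) (Vec.there (Vec.there y∈)) e
    from ind (suc zero) v _ v∈ e with decode-injective {v} {zero} (pendant-neighbour e)
    from ind (suc zero) .zero _ () e | refl
    from ind u (suc zero) u∈ _ e with decode-injective {u} {zero} (pendant-neighbour (E-sym J {u} {suc zero} e))
    from ind .zero (suc zero) () _ e | refl

  sumWeights-joinComponents : sumSubsets (suc (suc (n ℕ.+ n))) (weight J) ≡ - sumSubsets n (weight B)
  sumWeights-joinComponents = begin
    sumSubsets (suc (suc (n ℕ.+ n))) (weight J)
      ≡⟨ sumSubsets-pendant (weight J) (λ R → weight-dependent J {inside ∷ inside ∷ R} λ ind → ind zero (suc zero) Vec.here (Vec.there Vec.here) _)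
                                       (λ R → weight-suc {G = J} {H = J} {S = outside ∷ inside ∷ R} (independent-pendantToggle R) refl) ⟩
    sumSubsets (n ℕ.+ n) (λ R → weight J (inside ∷ outside ∷ R))
      ≡⟨ sumSubsets-outsidePrefix n (λ R → weight J (inside ∷ outside ∷ R))
           (λ R j j∈ → weight-dependent J {inside ∷ outside ∷ R} λ ind → ind zero (encode (link j)) Vec.here (Vec.there (Vec.there j∈)) (E-encode {hub} {link j} _)) ⟩
    sumSubsets n (λ T → weight J (inside ∷ outside ∷ (∅ Vec.++ T)))
      ≡⟨ sumSubsets-cong (λ T → weight-suc {G = J} {H = B} {S = inside ∷ outside ∷ (∅ Vec.++ T)} (independent-hubAndBase T) (cong suc (trans (∣++∣ (∅ {n}) T) (cong (ℕ._+ ∣ T ∣) (∣⊥∣≡0 n))))) ⟩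
    sumSubsets n (λ T → - weight B T)
      ≡⟨ sumSubsets-neg (weight B) ⟩
    - sumSubsets n (weight B) ∎

  kqGraph-joinComponents : ∀ {k q} → KQGraph B k q → Connected J × KQGraph J k (- q)
  kqGraph-joinComponents {q = q} (φB , IB) = joinComponents-connected , decyclingNumber-joinComponents φB , (begin
    indepPolyAtMinusOne J                         ≡⟨ indepPolyAtMinusOne≡sumWeights J ⟩
    sumSubsets (suc (suc (n ℕ.+ n))) (weight J)   ≡⟨ sumWeights-joinComponents ⟩
    - sumSubsets n (weight B)                     ≡⟨ cong -_ (indepPolyAtMinusOne≡sumWeights B) ⟨
    - indepPolyAtMinusOne B                       ≡⟨ cong -_ IB ⟩
    - q                                           ∎)

corollary2p5 : (G : Graph) (k : ℕ) (q : ℤ) → KQGraph G k q →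
    (Σ Graph λ H → Connected H × KQGraph H (suc k) (+ 2 * q))
    × (Σ Graph λ H → Connected H × KQGraph H k (- q))
corollary2p5 G k q kqG =
  (joinComponents K₃⊎G , connected , φ , trans I −−2q≡2q) , (joinComponents G , kqGraph-joinComponents G kqG)
  where
  K₃⊎G : Graph
  K₃⊎G = triangle ⊎ᴳ G
  joined : Connected (joinComponents K₃⊎G) × KQGraph (joinComponents K₃⊎G) (suc k) (- (- + 2 * q))
  joined = kqGraph-joinComponents K₃⊎G (kqGraph-⊎ triangle G kqGraph-triangle kqG)
  connected = proj₁ joined
  φ = proj₁ (proj₂ joined)
  I = proj₂ (proj₂ joined)
  −−2q≡2q : - (- + 2 * q) ≡ + 2 * q
  −−2q≡2q = trans (ℤP.neg-distribˡ-* (- + 2) q) (cong (_* q) (ℤP.neg-involutive (+ 2)))
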